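{- For every integer $m\ge 1$, the adjacency matrix ${\cal T}^*_m$ of the digraph ${\cal D}^*_m$ is symmetric.
   Context: Alpha-letters (2-element subsets of the directions up, down, left, right): $a=\{\text{right},\text{down}\}$, $b=\{\text{up},\text{down}\}$, $c=\{\text{right},\text{up}\}$, $d=\{\text{left},\text{down}\}$, $e=\{\text{left},\text{right}\}$, $f=\{\text{left},\text{up}\}$. ${\cal D}_{ud}$: arc $(\alpha,\beta)$ iff ($\text{down}\in\alpha\iff\text{up}\in\beta$); ${\cal D}_{lr}$: arc $(\alpha,\beta)$ iff ($\text{right}\in\alpha\iff\text{left}\in\beta$). ${\cal D}_m$: vertices are the words $\alpha_1\cdots\alpha_m\in\{a,\dots,f\}^m$ with $(\alpha_i,\alpha_{i+1})$ an arc of ${\cal D}_{ud}$ for $1\le i\le m$ ($\alpha_{m+1}:=\alpha_1$); arc $v\to u$ iff $(v_i,u_i)$ is an arc of ${\cal D}_{lr}$ for all $i$. The outlet word $o(\alpha)\in\{0,1\}^m$ has $o_j=1$ iff $\alpha_j\in\{a,c,e\}$; the inlet word $i(\alpha)\in\{0,1\}^m$ has $i_j=1$ iff $\alpha_j\in\{d,e,f\}$. ${\cal D}^*_m$ is the directed multigraph obtained from ${\cal D}_m$ by merging all vertices with a common outlet word: its vertex set is $\{o(x):x\in V({\cal D}_m)\}$, and for vertices $v,w$ the number of arcs from $v$ to $w$ (the $(v,w)$-entry of ${\cal T}^*_m$) is $|\{y\in V({\cal D}_m): i(y)=v,\ o(y)=w\}|$. -}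

module Defs where

open import Data.Bool using (Bool; true; false)
import Data.Bool.Properties as BoolP
open import Data.Nat using (ℕ; zero; suc; _%_)
open import Data.Nat.DivMod using (m%n<n)
open import Data.Fin using (Fin; toℕ; fromℕ<)
open import Data.Fin.Properties using (all?)
open import Data.Vec using (Vec; []; _∷_; lookup; map)
open import Data.Vec.Properties using (≡-dec)
open import Data.List using (List; []; _∷_; length; filter; concatMap)
import Data.List as L
open import Data.Product using (_×_; ∃)
open import Relation.Nullary using (Dec)
open import Relation.Nullary.Decidable using (_×-dec_)
open import Relation.Binary.PropositionalEquality using (_≡_)

data Dir : Set where
  up down left right : Dir

-- The six alpha-letters (2-element subsets of directions).
data Letter : Set where
  a b c d e f : Letter

_∈L_ : Dir → Letter → Bool
right ∈L a = true
down  ∈L a = true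
up    ∈L b = true
down  ∈L b = true
right ∈L c = true
up    ∈L c = true
left  ∈L d = true
down  ∈L d = true
left  ∈L e = true
right ∈L e = true
left  ∈L f = true
up    ∈L f = true
_     ∈L _ = false

ArcUD : Letter → Letter → Set
ArcUD α β = (down ∈L α) ≡ (up ∈L β)

arcUD? : (α β : Letter) → Dec (ArcUD α β)
arcUD? α β = (down ∈L α) BoolP.≟ (up ∈L β)

ArcLR : Letter → Letter → Set
ArcLR α β = (right ∈L α) ≡ (left ∈L β)

-- cyclic successor i ↦ (i+1) mod m on Fin m (m ≥ 1, written m = suc n)
next : ∀ {n} → Fin (suc n) → Fin (suc n)
next {n} i = fromℕ< (m%n<n (suc (toℕ i)) (suc n))

IsVertexDm : ∀ {n} → Vec Letter (suc n) → Set
IsVertexDm x = ∀ i → ArcUD (lookup x i) (lookup x (next i))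

isVertexDm? : ∀ {n} (x : Vec Letter (suc n)) → Dec (IsVertexDm x)
isVertexDm? x = all? (λ i → arcUD? (lookup x i) (lookup x (next i)))

-- arcs of D_m (not needed for T*_m, recorded for completeness)
ArcDm : ∀ {n} → Vec Letter (suc n) → Vec Letter (suc n) → Set
ArcDm v u = ∀ i → ArcLR (lookup v i) (lookup u i)

outletL : Letter → Bool
outletL a = true
outletL c = true
outletL e = true
outletL _ = false

inletL : Letter → Bool
inletL d = true
inletL e = true
inletL f = true
inletL _ = false

outlet : ∀ {m} → Vec Letter m → Vec Bool m
outlet = map outletL

inlet : ∀ {m} → Vec Letter m → Vec Bool m
inlet = map inletL

allLetters : List Letter
allLetters = a ∷ b ∷ c ∷ d ∷ e ∷ f ∷ []

allWords : (m : ℕ) → List (Vec Letter m)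
allWords zero    = [] ∷ []
allWords (suc m) = concatMap (λ α → L.map (α ∷_) (allWords m)) allLetters

IsVertexD* : ∀ {n} → Vec Bool (suc n) → Set
IsVertexD* v = ∃ λ x → IsVertexDm x × outlet x ≡ v

T* : ∀ {n} → Vec Bool (suc n) → Vec Bool (suc n) → ℕ
T* {n} v w =
  length (filter (λ y → isVertexDm? y ×-dec (≡-dec BoolP._≟_ (inlet y) v
                                        ×-dec ≡-dec BoolP._≟_ (outlet y) w))
                 (allWords (suc n)))

-- Reflecting a letter in the vertical axis (left ↔ right) fixes its up/down
-- memberships and exchanges the outlet letters a, c with the inlet letters d, f
-- (e is fixed). Applied letterwise it is a bijection of V(D_m) that swaps inlet
-- and outlet words, so it matches the y with i(y) = v, o(y) = w one-to-one with
-- those with i(y) = w, o(y) = v.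
module Submission where

open import Defs
open import Data.Nat using (ℕ; zero; suc)
open import Data.Bool using (Bool)
open import Data.Vec using (Vec; lookup)
import Data.Vec as Vec
import Data.Vec.Properties as Vecₚ
open import Data.List using (List; []; _∷_; length; map; filter; concatMap)
import Data.List.Properties as Listₚ
open import Data.List.Relation.Binary.Permutation.Propositional
  using (_↭_; ↭-refl; ↭-sym; prep; swap; module PermutationReasoning)
open import Data.List.Relation.Binary.Permutation.Propositional.Properties
  using (shift; filter-↭; ↭-length)
open import Data.List.Relation.Binary.BagAndSetEquality
  using (bag; _∼[_]_; [_]-Equality; >>=-cong; map-cong; ↭⇒∼bag; ∼bag⇒↭)
open import Data.Product using (_×_; _,_)
open import Function using (id; _∘_)
open import Function.Bundles using (_⇔_; mk⇔; Equivalence)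
open import Function.Properties.Inverse using (↔-refl)
open import Level using (Level; 0ℓ)
open import Relation.Unary using (Pred; Decidable; _≐_)
open import Relation.Nullary using (yes; no)
open import Relation.Nullary.Decidable using (_×-dec_)
open import Relation.Binary.PropositionalEquality as ≡
  using (_≡_; refl; cong; cong₂; subst; module ≡-Reasoning)
import Relation.Binary.Reasoning.Setoid as SetoidReasoning
import Data.Bool.Properties as Boolₚ

private
  variable
    ℓ p : Level
    A B : Set ℓ

length-filter-map : ∀ {P : Pred B p} (P? : Decidable P) (h : A → B) xs →
                    length (filter P? (map h xs)) ≡ length (filter (P? ∘ h) xs)
length-filter-map P? h []       = refl
length-filter-map P? h (x ∷ xs) with P? (h x)
... | yes _ = cong suc (length-filter-map P? h xs)
... | no  _ = length-filter-map P? h xs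

length-filter-↭ : ∀ {P : Pred A p} (P? : Decidable P) {xs ys : List A} → xs ↭ ys →
                  length (filter P? xs) ≡ length (filter P? ys)
length-filter-↭ P? = ↭-length ∘ filter-↭ P?

allWords-map-∼bag : (g : Letter → Letter) → map g allLetters ∼[ bag ] allLetters →
                    ∀ m → map (Vec.map g) (allWords m) ∼[ bag ] allWords m
allWords-map-∼bag g g-permutes zero    = ↔-refl
allWords-map-∼bag g g-permutes (suc m) = begin
  map (Vec.map g) (concatMap prefixed allLetters)
    ≡⟨ Listₚ.map-concatMap (Vec.map g) prefixed allLetters ⟩
  concatMap (map (Vec.map g) ∘ prefixed) allLetters
    ≡⟨ Listₚ.concatMap-cong map-prefixed allLetters ⟩
  concatMap (λ α → map (g α Vec.∷_) (map (Vec.map g) W)) allLetters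
    ≈⟨ >>=-cong {xs = allLetters} ↔-refl prefixed-∼bag ⟩
  concatMap (prefixed ∘ g) allLetters
    ≡⟨ Listₚ.concatMap-map prefixed g allLetters ⟨
  concatMap prefixed (map g allLetters)
    ≈⟨ >>=-cong {f = prefixed} {g = prefixed} g-permutes (λ _ → ↔-refl) ⟩
  concatMap prefixed allLetters ∎
  where
  W = allWords m
  prefixed : Letter → List (Vec Letter (suc m))
  prefixed α = map (α Vec.∷_) W
  map-prefixed : ∀ α → map (Vec.map g) (prefixed α) ≡ map (g α Vec.∷_) (map (Vec.map g) W)
  map-prefixed α = ≡.trans (≡.sym (Listₚ.map-∘ W)) (Listₚ.map-∘ W)
  prefixed-∼bag : ∀ α → map (g α Vec.∷_) (map (Vec.map g) W) ∼[ bag ] prefixed (g α)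
  prefixed-∼bag α = map-cong (λ _ → refl) (allWords-map-∼bag g g-permutes m)
  open SetoidReasoning ([ bag ]-Equality (Vec Letter (suc m)))

mirror : Letter → Letter
mirror a = d
mirror b = b
mirror c = f
mirror d = a
mirror e = e
mirror f = c

up∈L-mirror : ∀ α → up ∈L mirror α ≡ up ∈L α
up∈L-mirror a = refl
up∈L-mirror b = refl
up∈L-mirror c = refl
up∈L-mirror d = refl
up∈L-mirror e = refl
up∈L-mirror f = refl

down∈L-mirror : ∀ α → down ∈L mirror α ≡ down ∈L α
down∈L-mirror a = refl
down∈L-mirror b = refl
down∈L-mirror c = refl
down∈L-mirror d = refl
down∈L-mirror e = refl
down∈L-mirror f = refl

inletL-mirror : ∀ α → inletL (mirror α) ≡ outletL α
inletL-mirror a = refl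
inletL-mirror b = refl
inletL-mirror c = refl
inletL-mirror d = refl
inletL-mirror e = refl
inletL-mirror f = refl

outletL-mirror : ∀ α → outletL (mirror α) ≡ inletL α
outletL-mirror a = refl
outletL-mirror b = refl
outletL-mirror c = refl
outletL-mirror d = refl
outletL-mirror e = refl
outletL-mirror f = refl

ArcUD-mirror : ∀ α β → ArcUD (mirror α) (mirror β) ≡ ArcUD α β
ArcUD-mirror α β = cong₂ _≡_ (down∈L-mirror α) (up∈L-mirror β)

map-mirror-allLetters : map mirror allLetters ↭ allLetters
map-mirror-allLetters = begin
  d ∷ b ∷ f ∷ a ∷ e ∷ c ∷ [] ↭⟨ shift a (d ∷ b ∷ f ∷ []) (e ∷ c ∷ []) ⟩
  a ∷ d ∷ b ∷ f ∷ e ∷ c ∷ [] ↭⟨ prep a (swap d b ↭-refl) ⟩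
  a ∷ b ∷ d ∷ f ∷ e ∷ c ∷ [] ↭⟨ prep a (prep b (shift c (d ∷ f ∷ e ∷ []) [])) ⟩
  a ∷ b ∷ c ∷ d ∷ f ∷ e ∷ [] ↭⟨ prep a (prep b (prep c (prep d (swap f e ↭-refl)))) ⟩
  a ∷ b ∷ c ∷ d ∷ e ∷ f ∷ [] ∎
  where open PermutationReasoning

mirrorWord : ∀ {m} → Vec Letter m → Vec Letter m
mirrorWord = Vec.map mirror

inlet-mirrorWord : ∀ {m} (x : Vec Letter m) → inlet (mirrorWord x) ≡ outlet x
inlet-mirrorWord x =
  ≡.trans (≡.sym (Vecₚ.map-∘ inletL mirror x)) (Vecₚ.map-cong inletL-mirror x)

outlet-mirrorWord : ∀ {m} (x : Vec Letter m) → outlet (mirrorWord x) ≡ inlet x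
outlet-mirrorWord x =
  ≡.trans (≡.sym (Vecₚ.map-∘ outletL mirror x)) (Vecₚ.map-cong outletL-mirror x)

IsVertexDm-mirrorWord : ∀ {n} (x : Vec Letter (suc n)) → IsVertexDm (mirrorWord x) ⇔ IsVertexDm x
IsVertexDm-mirrorWord x =
  mk⇔ (λ p i → subst id (arc i) (p i)) (λ p i → subst id (≡.sym (arc i)) (p i))
  where
  arc : ∀ i → ArcUD (lookup (mirrorWord x) i) (lookup (mirrorWord x) (next i))
            ≡ ArcUD (lookup x i) (lookup x (next i))
  arc i rewrite Vecₚ.lookup-map i mirror x | Vecₚ.lookup-map (next i) mirror x = ArcUD-mirror _ _

ArcD* : ∀ {n} → Vec Bool (suc n) → Vec Bool (suc n) → Pred (Vec Letter (suc n)) 0ℓ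
ArcD* v w y = IsVertexDm y × inlet y ≡ v × outlet y ≡ w

mirrorWord-reverses-ArcD* : ∀ {n} (v w : Vec Bool (suc n)) → ArcD* v w ∘ mirrorWord ≐ ArcD* w v
mirrorWord-reverses-ArcD* v w =
    (λ { {y} (p , q , r) → Equivalence.to (IsVertexDm-mirrorWord y) p
                          , ≡.trans (≡.sym (outlet-mirrorWord y)) r
                          , ≡.trans (≡.sym (inlet-mirrorWord y)) q })
  , (λ { {y} (p , q , r) → Equivalence.from (IsVertexDm-mirrorWord y) p
                          , ≡.trans (inlet-mirrorWord y) r
                          , ≡.trans (outlet-mirrorWord y) q })

mirrorWord-permutes-allWords : ∀ m → map mirrorWord (allWords m) ↭ allWords m
mirrorWord-permutes-allWords m =
  ∼bag⇒↭ (allWords-map-∼bag mirror (↭⇒∼bag map-mirror-allLetters) m)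

-- Literally the decision procedure inside T*, so that T* v w unfolds to a count of arcD*? v w.
arcD*? : ∀ {n} (v w : Vec Bool (suc n)) → Decidable (ArcD* v w)
arcD*? v w y = isVertexDm? y ×-dec (Vecₚ.≡-dec Boolₚ._≟_ (inlet y) v
                                ×-dec Vecₚ.≡-dec Boolₚ._≟_ (outlet y) w)

T*-symmetric : ∀ {n} (v w : Vec Bool (suc n)) → T* v w ≡ T* w v
T*-symmetric {n} v w = begin
  length (filter (arcD*? v w) W)
    ≡⟨ length-filter-↭ (arcD*? v w) (↭-sym (mirrorWord-permutes-allWords (suc n))) ⟩
  length (filter (arcD*? v w) (map mirrorWord W))
    ≡⟨ length-filter-map (arcD*? v w) mirrorWord W ⟩
  length (filter (arcD*? v w ∘ mirrorWord) W)
    ≡⟨ cong length (Listₚ.filter-≐ _ (arcD*? w v) (mirrorWord-reverses-ArcD* v w) W) ⟩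
  length (filter (arcD*? w v) W) ∎
  where
  W = allWords (suc n)
  open ≡-Reasoning

theorem1 : (n : ℕ) → (v w : Vec Bool (suc n)) → IsVertexD* v → IsVertexD* w → T* v w ≡ T* w v
theorem1 n v w _ _ = T*-symmetric v w
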